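{- Let $\mathcal{T}$ be a tanglegram and let $e,f\in\sigma_{\mathcal{T}}$ be a safe pair in $\mathcal{T}$. Then $e$ and $f$ do not cross in any optimal layout of $\mathcal{T}$.
   Context: A rooted tree is a tree with at least two vertices and a designated root of degree $1$; leaves are non-root vertices of degree $1$; a rooted binary tree is a rooted tree in which every other vertex of degree at least $2$ has degree $3$. Two leaves form a cherry if they have the same neighbor. A tanglegram $\mathcal{T}=(L_{\mathcal{T}},R_{\mathcal{T}},\sigma_{\mathcal{T}})$ consists of two rooted binary trees with equally many leaves and a perfect matching $\sigma_{\mathcal{T}}$ between their leaf sets. Two distinct matching edges $e,f$ form a safe pair if their endpoints in $L_{\mathcal{T}}$ form a cherry of $L_{\mathcal{T}}$ or their endpoints in $R_{\mathcal{T}}$ form a cherry of $R_{\mathcal{T}}$. A plane drawing of a rooted tree is a straight-line crossing-free drawing with all leaves on a line (the leaf-line), all other vertices in one open half-plane of it, and each vertex strictly closer to the leaf-line than its proper ancestors (vertices on its path to the root). A layout of $\mathcal{T}$ is a straight-line drawing where both trees are drawn as plane drawings with parallel leaf-lines, both trees lie outside the strip between the leaf-lines, and the matching edges are straight segments. Its crossing number is the number of unordered pairs of matching edges that cross; $\operatorname{crt}(\mathcal{T})$ is the minimum crossing number over all layouts, and a layout is optimal if its crossing number equals $\operatorname{crt}(\mathcal{T})$. -}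

module Defs where

open import Data.Nat using (ℕ; zero; suc; _+_; _≤_; _<ᵇ_)
open import Data.Fin using (Fin; toℕ; _≟_)
open import Data.Bool using (Bool; true; false; if_then_else_; _∧_; _xor_)
open import Data.List using (List; []; _∷_; _++_; map; allFin)
open import Data.Nat.ListAction using (sum)
open import Data.List.Relation.Binary.Permutation.Propositional using (_↭_)
open import Data.Product using (_×_; _,_)
open import Data.Sum using (_⊎_)
open import Relation.Nullary using (¬_)
open import Relation.Nullary.Decidable using (⌊_⌋)
open import Relation.Binary.PropositionalEquality using (_≡_)

-- A rooted binary tree (root of degree 1, other non-leaf vertices of
-- degree 3) is determined by the full binary tree hanging below the
-- unique child of the root.  Leaves carry labels in Fin n; the label of a
-- leaf names the matching edge incident to it.
data Tree (n : ℕ) : Set where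
  leaf : Fin n → Tree n
  node : Tree n → Tree n → Tree n

leaves : ∀ {n} → Tree n → List (Fin n)
leaves (leaf a)   = a ∷ []
leaves (node l r) = leaves l ++ leaves r

WellLabelled : ∀ {n} → Tree n → Set
WellLabelled {n} t = leaves t ↭ allFin n

-- A tanglegram with n matching edges: two rooted binary trees whose leaves
-- are labelled bijectively by Fin n; matching edge i joins the leaf labelled
-- i in L with the leaf labelled i in R.
record Tanglegram (n : ℕ) : Set where
  constructor tanglegram
  field
    L R   : Tree n
    L-wl  : WellLabelled L
    R-wl  : WellLabelled R
open Tanglegram public

data Cherry {n : ℕ} (a b : Fin n) : Tree n → Set where
  here   : Cherry a b (node (leaf a) (leaf b))
  here'  : Cherry a b (node (leaf b) (leaf a))
  left   : ∀ {l r} → Cherry a b l → Cherry a b (node l r)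
  right  : ∀ {l r} → Cherry a b r → Cherry a b (node l r)

SafePair : ∀ {n} → Tanglegram n → Fin n → Fin n → Set
SafePair T e f = ¬ (e ≡ f) × (Cherry e f (L T) ⊎ Cherry e f (R T))

-- Plane drawings of a tree, up to the combinatorics relevant for crossings:
-- a plane drawing is determined (as far as the left-to-right order of the
-- leaves on the leaf-line is concerned) by choosing, at every internal
-- vertex, which child is drawn first.  t ≈ t' means that t' is t with the
-- children of some internal vertices swapped; leaves t' is then the leaf
-- order of the corresponding plane drawing.
data _≈_ {n : ℕ} : Tree n → Tree n → Set where
  leaf : ∀ {a} → leaf a ≈ leaf a
  keep : ∀ {a b a' b'} → a ≈ a' → b ≈ b' → node a b ≈ node a' b'
  swap : ∀ {a b a' b'} → a ≈ b' → b ≈ a' → node a b ≈ node a' b'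

-- A layout: plane drawings of both trees (leaf orders read along the
-- two parallel leaf-lines in the same direction).
record Layout {n : ℕ} (T : Tanglegram n) : Set where
  constructor layout
  field
    L' R'  : Tree n
    L≈     : L T ≈ L'
    R≈     : R T ≈ R'
open Layout public

pos : ∀ {n} → Fin n → List (Fin n) → ℕ
pos i []       = 0
pos i (x ∷ xs) = if ⌊ i ≟ x ⌋ then 0 else suc (pos i xs)

-- matching edges e and f cross in the layout iff their endpoints appear in
-- opposite orders on the two leaf-lines
crosses : ∀ {n} {T : Tanglegram n} → Layout T → Fin n → Fin n → Bool
crosses Λ e f =
  (pos e (leaves (L' Λ)) <ᵇ pos f (leaves (L' Λ)))
  xor (pos e (leaves (R' Λ)) <ᵇ pos f (leaves (R' Λ)))

countPairs : ∀ {n} → (Fin n → Fin n → Bool) → ℕ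
countPairs {n} c =
  sum (map (λ e → sum (map (λ f → if (toℕ e <ᵇ toℕ f) ∧ c e f then 1 else 0)
                           (allFin n)))
           (allFin n))

crossingNumber : ∀ {n} {T : Tanglegram n} → Layout T → ℕ
crossingNumber Λ = countPairs (crosses Λ)

Optimal : ∀ {n} {T : Tanglegram n} → Layout T → Set
Optimal {T = T} Λ = (Λ' : Layout T) → crossingNumber Λ ≤ crossingNumber Λ'

-- In every plane drawing the two leaves of a cherry are adjacent on the leaf-line,
-- and swapping the children of their parent gives another plane drawing.  This
-- transposition of adjacent leaves reverses the relative order of exactly one pair
-- of matching edges, the safe pair itself: it toggles whether that pair crosses
-- and leaves every other pair as it was.  So if a safe pair crossed, the swap
-- would remove exactly one crossing, contradicting optimality.  A cherry of the
-- right tree is reduced to one of the left tree by exchanging the two trees.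
module Submission where

open import Defs
open import Data.Nat using (ℕ; _≤_; _<_; _<ᵇ_; z≤n; s≤s)
open import Data.Nat.Properties using (<⇒<ᵇ; <⇒≱; <-cmp; ≤-refl; +-mono-≤; +-mono-<-≤; +-mono-≤-<)
open import Data.Nat.ListAction using (sum)
open import Data.Fin using (Fin; toℕ; _≟_)
open import Data.Fin.Properties using (toℕ-injective)
open import Data.Bool as Bool using (Bool; true; false; not; _∧_; _xor_; if_then_else_; T; f≤t; b≤b; f<t)
open import Data.Bool.Properties using (xor-comm; not-involutive; not-distribˡ-xor; ≤-minimum; ¬-not)
import Data.Bool.Properties as Bool
open import Data.List using (List; []; _∷_; _++_; map; allFin)
open import Data.List.Properties using (map-cong; ++-assoc)
open import Data.List.Membership.Propositional using (_∈_)
open import Data.List.Membership.Propositional.Properties using (∈-allFin; ∈-++⁺ʳ)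
open import Data.List.Relation.Unary.Any using (here; there; tail)
open import Data.List.Relation.Unary.All using (_∷_; lookup)
open import Data.List.Relation.Unary.AllPairs using (_∷_)
open import Data.List.Relation.Unary.Unique.Propositional using (Unique)
open import Data.List.Relation.Unary.Unique.Propositional.Properties using (allFin⁺)
open import Data.List.Relation.Binary.Permutation.Propositional using (_↭_; ↭-refl; ↭-trans; ↭-sym; ↭⇒↭ₛ)
open import Data.List.Relation.Binary.Permutation.Propositional.Properties using (++⁺; ++-comm; ∈-resp-↭)
open import Data.List.Relation.Binary.Permutation.Setoid.Properties using (Unique-resp-↭)
open import Data.Product using (_×_; _,_)
open import Data.Sum using (_⊎_; inj₁; inj₂; [_,_])
import Data.Sum as Sum
open import Data.Empty using (⊥; ⊥-elim)
open import Relation.Nullary using (¬_; yes; no; _×-dec_)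
open import Relation.Binary.Definitions using (tri<; tri≈; tri>)
open import Relation.Binary.PropositionalEquality using (_≡_; _≢_; refl; sym; trans; cong; cong₂; subst₂; setoid; module ≡-Reasoning)
open ≡-Reasoning

private
  variable
    n : ℕ
    a b x y : Fin n
    B P Q : List (Fin n)
    t t' : Tree n

before : List (Fin n) → Fin n → Fin n → Bool
before l a b = pos a l <ᵇ pos b l

cross : List (Fin n) → List (Fin n) → Fin n → Fin n → Bool
cross P Q a b = before P a b xor before Q a b

before-antisym : a ∈ P → b ∈ P → a ≢ b → before P b a ≡ not (before P a b)
before-antisym {a = a} {P = c ∷ P} {b = b} a∈ b∈ a≢b with a ≟ c | b ≟ c
... | yes refl | yes refl = ⊥-elim (a≢b refl)
... | yes _    | no _     = refl
... | no _     | yes _    = refl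
... | no a≢c   | no b≢c   = before-antisym (tail a≢c a∈) (tail b≢c b∈) a≢b

before-transpose-other : ∀ A → ¬ (a ≡ x × b ≡ y) → ¬ (a ≡ y × b ≡ x) →
                         before (A ++ y ∷ x ∷ B) a b ≡ before (A ++ x ∷ y ∷ B) a b
before-transpose-other {a = a} {x = x} {b = b} {y = y} [] ¬xy ¬yx
  with a ≟ x | a ≟ y | b ≟ x | b ≟ y
... | yes a≡x | _       | _       | yes b≡y = ⊥-elim (¬xy (a≡x , b≡y))
... | _       | yes a≡y | yes b≡x | _       = ⊥-elim (¬yx (a≡y , b≡x))
-- As {a, b} ≠ {x, y}, swapping the first two positions cannot affect the
-- comparison: each remaining case computes to the same Boolean on both sides.
... | yes _ | yes _ | no _  | no _  = refl
... | yes _ | no _  | yes _ | no _  = refl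
... | yes _ | no _  | no _  | no _  = refl
... | no _  | yes _ | no _  | yes _ = refl
... | no _  | yes _ | no _  | no _  = refl
... | no _  | no _  | yes _ | yes _ = refl
... | no _  | no _  | yes _ | no _  = refl
... | no _  | no _  | no _  | yes _ = refl
... | no _  | no _  | no _  | no _  = refl
before-transpose-other {a = a} {b = b} (c ∷ A) ¬xy ¬yx with a ≟ c | b ≟ c
... | yes _ | yes _ = refl
... | yes _ | no _  = refl
... | no _  | yes _ = refl
... | no _  | no _  = before-transpose-other A ¬xy ¬yx

before-transpose-pair : ∀ A → Unique (A ++ x ∷ y ∷ B) →
                        before (A ++ y ∷ x ∷ B) x y ≡ not (before (A ++ x ∷ y ∷ B) x y)
before-transpose-pair {x = x} {y = y} [] ((x≢y ∷ _) ∷ _) with x ≟ y | y ≟ x | x ≟ x | y ≟ y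
... | yes x≡y | _       | _       | _       = ⊥-elim (x≢y x≡y)
... | no _    | yes y≡x | _       | _       = ⊥-elim (x≢y (sym y≡x))
... | no _    | no _    | no x≢x  | _       = ⊥-elim (x≢x refl)
... | no _    | no _    | yes _   | no y≢y  = ⊥-elim (y≢y refl)
... | no _    | no _    | yes _   | yes _   = refl
before-transpose-pair {x = x} {y = y} (c ∷ A) (c∉ ∷ u) with x ≟ c | y ≟ c
... | yes x≡c | _       = ⊥-elim (lookup c∉ (∈-++⁺ʳ A (here refl)) (sym x≡c))
... | no _    | yes y≡c = ⊥-elim (lookup c∉ (∈-++⁺ʳ A (there (here refl))) (sym y≡c))
... | no _    | no _    = before-transpose-pair A u

xor-not-not : ∀ p q → not p xor not q ≡ p xor q
xor-not-not true  q = refl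
xor-not-not false q = not-involutive q

cross-sym : a ∈ P → b ∈ P → a ∈ Q → b ∈ Q → a ≢ b → cross P Q b a ≡ cross P Q a b
cross-sym {a = a} {P = P} {b = b} {Q = Q} a∈P b∈P a∈Q b∈Q a≢b =
  trans (cong₂ _xor_ (before-antisym a∈P b∈P a≢b) (before-antisym a∈Q b∈Q a≢b))
        (xor-not-not (before P a b) (before Q a b))

sum-map-mono-≤ : ∀ {X : Set} {f g : X → ℕ} → (∀ x → f x ≤ g x) → ∀ xs → sum (map f xs) ≤ sum (map g xs)
sum-map-mono-≤ f≤g []       = z≤n
sum-map-mono-≤ f≤g (x ∷ xs) = +-mono-≤ (f≤g x) (sum-map-mono-≤ f≤g xs)

sum-map-mono-< : ∀ {X : Set} {f g : X → ℕ} {x xs} → (∀ x → f x ≤ g x) → x ∈ xs → f x < g x →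
                 sum (map f xs) < sum (map g xs)
sum-map-mono-< f≤g (here {xs = xs} refl) fx<gx = +-mono-<-≤ fx<gx (sum-map-mono-≤ f≤g xs)
sum-map-mono-< f≤g (there {x = x} x∈)    fx<gx = +-mono-≤-< (f≤g x) (sum-map-mono-< f≤g x∈ fx<gx)

indicator-mono : ∀ p {q r} → q Bool.≤ r → (if p ∧ q then 1 else 0) ≤ (if p ∧ r then 1 else 0)
indicator-mono false _   = z≤n
indicator-mono true  f≤t = z≤n
indicator-mono true  b≤b = ≤-refl

indicator-< : ∀ {p q r} → T p → q Bool.< r → (if p ∧ q then 1 else 0) < (if p ∧ r then 1 else 0)
indicator-< {true} _ f<t = s≤s z≤n

module _ {c c' : Fin n → Fin n → Bool} (c'≤c : ∀ a b → c' a b Bool.≤ c a b) where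

  countPairs-mono-<′ : toℕ a < toℕ b → c' a b Bool.< c a b → countPairs c' < countPairs c
  countPairs-mono-<′ {a = a} {b = b} a<b c'<c =
    sum-map-mono-< (λ u → sum-map-mono-≤ (entry-mono u) (allFin n)) (∈-allFin a)
      (sum-map-mono-< (entry-mono a) (∈-allFin b) (indicator-< (<⇒<ᵇ a<b) c'<c))
    where
    entry-mono : ∀ u v → (if (toℕ u <ᵇ toℕ v) ∧ c' u v then 1 else 0)
                       ≤ (if (toℕ u <ᵇ toℕ v) ∧ c u v then 1 else 0)
    entry-mono u v = indicator-mono (toℕ u <ᵇ toℕ v) (c'≤c u v)

  countPairs-mono-< : a ≢ b → c' a b Bool.< c a b → c' b a Bool.< c b a → countPairs c' < countPairs c
  countPairs-mono-< {a = a} {b = b} a≢b ab ba with <-cmp (toℕ a) (toℕ b)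
  ... | tri< a<b _ _ = countPairs-mono-<′ a<b ab
  ... | tri≈ _ a≡b _ = ⊥-elim (a≢b (toℕ-injective a≡b))
  ... | tri> _ _ b<a = countPairs-mono-<′ b<a ba

countPairs-cong : {c c' : Fin n → Fin n → Bool} → (∀ a b → c a b ≡ c' a b) → countPairs c ≡ countPairs c'
countPairs-cong {c = c} {c' = c'} c≗c' =
  cong sum (map-cong (λ a → cong sum (map-cong (entry-cong a) (allFin _))) (allFin _))
  where
  entry-cong : ∀ a b → (if (toℕ a <ᵇ toℕ b) ∧ c a b then 1 else 0)
                     ≡ (if (toℕ a <ᵇ toℕ b) ∧ c' a b then 1 else 0)
  entry-cong a b = cong (λ p → if (toℕ a <ᵇ toℕ b) ∧ p then 1 else 0) (c≗c' a b)

Unique-++⁻ʳ : ∀ A → Unique (A ++ B) → Unique B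
Unique-++⁻ʳ []      u       = u
Unique-++⁻ʳ (_ ∷ A) (_ ∷ u) = Unique-++⁻ʳ A u

module _ {A B Q : List (Fin n)} {x y : Fin n}
         (uniq : Unique (A ++ x ∷ y ∷ B)) (x∈Q : x ∈ Q) (y∈Q : y ∈ Q) where

  transpose-reduces-crossings : cross (A ++ x ∷ y ∷ B) Q x y ≡ true →
                                countPairs (cross (A ++ y ∷ x ∷ B) Q) < countPairs (cross (A ++ x ∷ y ∷ B) Q)
  transpose-reduces-crossings crossed =
    countPairs-mono-< c'≤c x≢y (false<true uncrossed crossed) (false<true uncrossed' crossed')
    where
    Lxy Lyx : List (Fin n)
    Lxy = A ++ x ∷ y ∷ B
    Lyx = A ++ y ∷ x ∷ B

    x≢y : x ≢ y
    x≢y with Unique-++⁻ʳ A uniq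
    ... | (x≢y ∷ _) ∷ _ = x≢y

    false<true : ∀ {p q} → p ≡ false → q ≡ true → p Bool.< q
    false<true refl refl = f<t

    false≤ : ∀ {p q} → p ≡ false → p Bool.≤ q
    false≤ refl = ≤-minimum _

    uncrossed : cross Lyx Q x y ≡ false
    uncrossed = begin
      before Lyx x y xor before Q x y        ≡⟨ cong (_xor before Q x y) (before-transpose-pair A uniq) ⟩
      not (before Lxy x y) xor before Q x y  ≡⟨ sym (not-distribˡ-xor (before Lxy x y) (before Q x y)) ⟩
      not (cross Lxy Q x y)                  ≡⟨ cong not crossed ⟩
      false                                  ∎

    crossed' : cross Lxy Q y x ≡ true
    crossed' = trans (cross-sym (∈-++⁺ʳ A (here refl)) (∈-++⁺ʳ A (there (here refl))) x∈Q y∈Q x≢y) crossed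

    uncrossed' : cross Lyx Q y x ≡ false
    uncrossed' = trans (cross-sym (∈-++⁺ʳ A (there (here refl))) (∈-++⁺ʳ A (here refl)) x∈Q y∈Q x≢y) uncrossed

    c'≤c : ∀ a b → cross Lyx Q a b Bool.≤ cross Lxy Q a b
    c'≤c a b with (a ≟ x) ×-dec (b ≟ y) | (a ≟ y) ×-dec (b ≟ x)
    ... | yes (refl , refl) | _                 = false≤ uncrossed
    ... | no _              | yes (refl , refl) = false≤ uncrossed'
    ... | no ¬xy            | no ¬yx            =
      Bool.≤-reflexive (cong (_xor before Q a b) (before-transpose-other A ¬xy ¬yx))

leaves-↭ : t ≈ t' → leaves t ↭ leaves t'
leaves-↭ leaf                           = ↭-refl
leaves-↭ (keep p q)                     = ++⁺ (leaves-↭ p) (leaves-↭ q)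
leaves-↭ (swap {a' = a'} {b' = b'} p q) = ↭-trans (++⁺ (leaves-↭ p) (leaves-↭ q)) (++-comm (leaves b') (leaves a'))

WellLabelled-resp-≈ : t ≈ t' → WellLabelled t → WellLabelled t'
WellLabelled-resp-≈ t≈t' wl = ↭-trans (↭-sym (leaves-↭ t≈t')) wl

↭-allFin⇒Unique : P ↭ allFin n → Unique P
↭-allFin⇒Unique P↭ = Unique-resp-↭ (setoid _) (↭⇒↭ₛ (↭-sym P↭)) (allFin⁺ _)

↭-allFin⇒∈ : P ↭ allFin n → ∀ i → i ∈ P
↭-allFin⇒∈ P↭ i = ∈-resp-↭ (↭-sym P↭) (∈-allFin i)

-- x and y are adjacent in the drawing t', and t'' is a drawing of t that differs
-- from t' only by transposing them.
record AdjacentSwap (t t' : Tree n) (x y : Fin n) : Set where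
  field
    prefix suffix : List (Fin n)
    t''           : Tree n
    t≈t''         : t ≈ t''
    leaves-t'     : leaves t' ≡ prefix ++ x ∷ y ∷ suffix
    leaves-t''    : leaves t'' ≡ prefix ++ y ∷ x ∷ suffix

swap-at-root : t ≈ node (leaf y) (leaf x) → AdjacentSwap t (node (leaf x) (leaf y)) x y
swap-at-root t≈yx = record { prefix = [] ; suffix = [] ; t'' = _ ; t≈t'' = t≈yx ; leaves-t' = refl ; leaves-t'' = refl }

swap-in-left : ∀ {u u' r' : Tree n} → (∀ {w} → u ≈ w → t ≈ node w r') →
               AdjacentSwap u u' x y → AdjacentSwap t (node u' r') x y
swap-in-left {x = x} {y = y} {r' = r'} embed s = record
  { prefix     = prefix
  ; suffix     = suffix ++ leaves r'
  ; t''        = node t'' r'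
  ; t≈t''      = embed t≈t''
  ; leaves-t'  = trans (cong (_++ leaves r') leaves-t') (++-assoc prefix (x ∷ y ∷ suffix) (leaves r'))
  ; leaves-t'' = trans (cong (_++ leaves r') leaves-t'') (++-assoc prefix (y ∷ x ∷ suffix) (leaves r'))
  }
  where open AdjacentSwap s

swap-in-right : ∀ {u u' l' : Tree n} → (∀ {w} → u ≈ w → t ≈ node l' w) →
                AdjacentSwap u u' x y → AdjacentSwap t (node l' u') x y
swap-in-right {x = x} {y = y} {l' = l'} embed s = record
  { prefix     = leaves l' ++ prefix
  ; suffix     = suffix
  ; t''        = node l' t''
  ; t≈t''      = embed t≈t''
  ; leaves-t'  = trans (cong (leaves l' ++_) leaves-t') (sym (++-assoc (leaves l') prefix (x ∷ y ∷ suffix)))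
  ; leaves-t'' = trans (cong (leaves l' ++_) leaves-t'') (sym (++-assoc (leaves l') prefix (y ∷ x ∷ suffix)))
  }
  where open AdjacentSwap s

AdjacentSwap± : Tree n → Tree n → Fin n → Fin n → Set
AdjacentSwap± t t' a b = AdjacentSwap t t' a b ⊎ AdjacentSwap t t' b a

map-AdjacentSwap± : ∀ {u u' : Tree n} → (∀ {x y} → AdjacentSwap u u' x y → AdjacentSwap t t' x y) →
                    AdjacentSwap± u u' a b → AdjacentSwap± t t' a b
map-AdjacentSwap± f = Sum.map f f

cherry-adjacent : Cherry a b t → t ≈ t' → AdjacentSwap± t t' a b
cherry-adjacent here      (keep leaf leaf) = inj₁ (swap-at-root (swap leaf leaf))
cherry-adjacent here      (swap leaf leaf) = inj₂ (swap-at-root (keep leaf leaf))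
cherry-adjacent here'     (keep leaf leaf) = inj₂ (swap-at-root (swap leaf leaf))
cherry-adjacent here'     (swap leaf leaf) = inj₁ (swap-at-root (keep leaf leaf))
cherry-adjacent (left c)  (keep p q) = map-AdjacentSwap± (swap-in-left  (λ p' → keep p' q)) (cherry-adjacent c p)
cherry-adjacent (left c)  (swap p q) = map-AdjacentSwap± (swap-in-right (λ p' → swap p' q)) (cherry-adjacent c p)
cherry-adjacent (right c) (keep p q) = map-AdjacentSwap± (swap-in-right (λ q' → keep p q')) (cherry-adjacent c q)
cherry-adjacent (right c) (swap p q) = map-AdjacentSwap± (swap-in-left  (λ q' → swap p q')) (cherry-adjacent c q)

module _ {T : Tanglegram n} (Λ : Layout T) where

  ∈-L' : ∀ i → i ∈ leaves (L' Λ)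
  ∈-L' = ↭-allFin⇒∈ (WellLabelled-resp-≈ (L≈ Λ) (L-wl T))

  ∈-R' : ∀ i → i ∈ leaves (R' Λ)
  ∈-R' = ↭-allFin⇒∈ (WellLabelled-resp-≈ (R≈ Λ) (R-wl T))

  crosses-sym : a ≢ b → crosses Λ b a ≡ crosses Λ a b
  crosses-sym {a = a} {b = b} = cross-sym (∈-L' a) (∈-L' b) (∈-R' a) (∈-R' b)

  redrawLeft : AdjacentSwap (L T) (L' Λ) x y → Layout T
  redrawLeft s = layout (AdjacentSwap.t'' s) (R' Λ) (AdjacentSwap.t≈t'' s) (R≈ Λ)

  redrawLeft-reduces-crossings : (s : AdjacentSwap (L T) (L' Λ) x y) → crosses Λ x y ≡ true →
                                 crossingNumber (redrawLeft s) < crossingNumber Λ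
  redrawLeft-reduces-crossings {x = x} {y = y} s =
    reduce leaves-t' leaves-t'' (↭-allFin⇒Unique (WellLabelled-resp-≈ (L≈ Λ) (L-wl T)))
    where
    open AdjacentSwap s
    reduce : ∀ {Lxy Lyx} → Lxy ≡ prefix ++ x ∷ y ∷ suffix → Lyx ≡ prefix ++ y ∷ x ∷ suffix → Unique Lxy →
             cross Lxy (leaves (R' Λ)) x y ≡ true →
             countPairs (cross Lyx (leaves (R' Λ))) < countPairs (cross Lxy (leaves (R' Λ)))
    reduce refl refl uniq = transpose-reduces-crossings uniq (∈-R' x) (∈-R' y)

left-cherry-uncrossed : {T : Tanglegram n} → Cherry a b (L T) → a ≢ b →
                        (Λ : Layout T) → Optimal Λ → crosses Λ a b ≡ false
left-cherry-uncrossed {a = a} {b = b} {T = T} cherry a≢b Λ opt =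
  ¬-not λ crossed →
    [ (λ s → improvable s crossed) , (λ s → improvable s (trans (crosses-sym Λ a≢b) crossed)) ]
    (cherry-adjacent cherry (L≈ Λ))
  where
  improvable : AdjacentSwap (L T) (L' Λ) x y → crosses Λ x y ≡ true → ⊥
  improvable s crossed = <⇒≱ (redrawLeft-reduces-crossings Λ s crossed) (opt (redrawLeft Λ s))

-- Exchanging the two trees changes no crossing; it turns a cherry of R into one of L.
mirror : Tanglegram n → Tanglegram n
mirror T = tanglegram (R T) (L T) (R-wl T) (L-wl T)

mirrorLayout : {T : Tanglegram n} → Layout T → Layout (mirror T)
mirrorLayout Λ = layout (R' Λ) (L' Λ) (R≈ Λ) (L≈ Λ)

crosses-mirror : {T : Tanglegram n} (Λ : Layout T) → ∀ a b → crosses (mirrorLayout Λ) a b ≡ crosses Λ a b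
crosses-mirror Λ a b = xor-comm (before (leaves (R' Λ)) a b) (before (leaves (L' Λ)) a b)

crossingNumber-mirror : {T : Tanglegram n} (Λ : Layout T) → crossingNumber (mirrorLayout Λ) ≡ crossingNumber Λ
crossingNumber-mirror Λ = countPairs-cong {c = crosses (mirrorLayout Λ)} {c' = crosses Λ} (crosses-mirror Λ)

mirror-optimal : {T : Tanglegram n} (Λ : Layout T) → Optimal Λ → Optimal (mirrorLayout Λ)
mirror-optimal Λ opt Λ' =
  subst₂ _≤_ (sym (crossingNumber-mirror Λ)) (crossingNumber-mirror Λ') (opt (mirrorLayout Λ'))

lemma4 : ∀ {n} (T : Tanglegram n) (e f : Fin n) → SafePair T e f →
         (Λ : Layout T) → Optimal Λ → crosses Λ e f ≡ false
lemma4 T e f (e≢f , inj₁ cherryL) Λ opt = left-cherry-uncrossed cherryL e≢f Λ opt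
lemma4 T e f (e≢f , inj₂ cherryR) Λ opt =
  trans (sym (crosses-mirror Λ e f))
        (left-cherry-uncrossed {T = mirror T} cherryR e≢f (mirrorLayout Λ) (mirror-optimal Λ opt))
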